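{- Let $H$ be a graph with vertex set $\{v_1,\ldots,v_n\}$. For $1\le i\le n$, let $G_i$ be a graph of order $n_i$ with $p(G_i;1)=n_i$, and let $u_i$ be any vertex of $G_i$, except that if $G_i$ is a path then $u_i$ is not an endpoint of that path. Let $G$ be the graph obtained from $H$ and disjoint copies of $G_1,\ldots,G_n$ by identifying $u_i$ with $v_i$ for each $1\le i\le n$. Then $$\mathcal{P}(G;x)=\prod_{i=1}^n\big((x+1)^{n_i}-1\big).$$
   Context: Graphs are finite and simple with nonempty vertex set. An endpoint of the path $P_m$ is a vertex of degree 1 if $m>1$, and the unique (degree 0) vertex if $m=1$. For $S\subseteq V(G)$, $S$ is a power dominating set if, after coloring $S$, coloring every neighbor of a vertex of $S$, and then repeatedly applying the forcing rule (a colored vertex with exactly one uncolored neighbor colors that neighbor) until no changes occur, all vertices are colored. $p(G;i)$ is the number of power dominating sets of size $i$, and $\mathcal{P}(G;x)=\sum_{i\ge 1} p(G;i)x^i$. -}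

module Defs where

open import Data.Nat as ℕ using (ℕ; zero; suc; _≡ᵇ_)
open import Data.Integer as ℤ using (ℤ; +_)
open import Data.Bool using (Bool; true; false; _∧_; _∨_; not; if_then_else_)
open import Data.Fin as Fin using (Fin; zero; suc; toℕ; splitAt)
open import Data.Fin.Subset using (Subset; ∣_∣)
open import Data.Vec as Vec using (Vec; []; _∷_)
open import Data.List as List using (List; []; _∷_; allFin; filterᵇ; length; applyUpTo)
open import Data.Bool.ListAction using (any; all)
open import Data.Product using (Σ; _,_; _×_)
open import Data.Sum using (_⊎_; inj₁; inj₂)
open import Function using (_∘_; id)
open import Function.Definitions using (Injective)
open import Relation.Binary.PropositionalEquality using (_≡_; refl)
open import Relation.Nullary using (¬_; yes; no)
open import Relation.Nullary.Decidable using (⌊_⌋)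

Adj : ℕ → Set
Adj n = Fin n → Fin n → Bool

record IsGraph {n : ℕ} (A : Adj n) : Set where
  field
    symmetric   : ∀ a b → A a b ≡ A b a
    irreflexive : ∀ a → A a a ≡ false

degree : {n : ℕ} → Adj n → Fin n → ℕ
degree {n} A v = length (filterᵇ (A v) (allFin n))

pathAdj : (m : ℕ) → Adj m
pathAdj m a b = (suc (toℕ a) ≡ᵇ toℕ b) ∨ (suc (toℕ b) ≡ᵇ toℕ a)

record IsPathVia {m : ℕ} (A : Adj m) (f : Fin m → Fin m) : Set where
  field
    injective : Injective _≡_ _≡_ f
    preserves : ∀ a b → A a b ≡ pathAdj m (f a) (f b)

IsPath : {m : ℕ} → Adj m → Set
IsPath {m} A = Σ (Fin m → Fin m) (IsPathVia A)

IsEndpoint : {m : ℕ} → Adj m → Fin m → Set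
IsEndpoint {m} A u = (m ≡ 1) ⊎ (degree A u ≡ 1)

inS : {n : ℕ} → Subset n → Fin n → Bool
inS S v = Vec.lookup S v

domStep : {n : ℕ} → Adj n → Subset n → Fin n → Bool
domStep {n} A S v = inS S v ∨ any (λ s → inS S s ∧ A s v) (allFin n)

-- one (simultaneous) round of the forcing rule: v becomes colored if some
-- colored neighbour u of v has all its neighbours other than v colored
forceStep : {n : ℕ} → Adj n → (Fin n → Bool) → Fin n → Bool
forceStep {n} A C v =
  C v ∨ any (λ u → C u ∧ A u v ∧
               all (λ w → ⌊ w Fin.≟ v ⌋ ∨ not (A u w) ∨ C w) (allFin n))
            (allFin n)

iter : {X : Set} → ℕ → (X → X) → X → X
iter zero    f x = x
iter (suc k) f x = f (iter k f x)

-- the final colored set: n rounds suffice to reach the fixed point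
colored : {n : ℕ} → Adj n → Subset n → Fin n → Bool
colored {n} A S = iter n (forceStep A) (domStep A S)

isPowerDominating : {n : ℕ} → Adj n → Subset n → Bool
isPowerDominating {n} A S = all (colored A S) (allFin n)

allSubsets : (n : ℕ) → List (Subset n)
allSubsets zero    = [] ∷ []
allSubsets (suc n) =
  List.map (true ∷_) (allSubsets n) List.++ List.map (false ∷_) (allSubsets n)

p : {n : ℕ} → Adj n → ℕ → ℕ
p {n} A i = length (filterᵇ (λ S → (∣ S ∣ ≡ᵇ i) ∧ isPowerDominating A S) (allSubsets n))

-- Polynomials with integer coefficients as coefficient lists
-- (constant coefficient first).

Poly : Set
Poly = List ℤ

_+P_ : Poly → Poly → Poly
[]       +P q        = q
(a ∷ p') +P []       = a ∷ p'
(a ∷ p') +P (b ∷ q)  = (a ℤ.+ b) ∷ (p' +P q)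

_*P_ : Poly → Poly → Poly
[]       *P q = []
(a ∷ p') *P q = List.map (a ℤ.*_) q +P (+ 0 ∷ (p' *P q))

negP : Poly → Poly
negP = List.map (λ a → ℤ.- a)

_-P_ : Poly → Poly → Poly
p' -P q = p' +P negP q

oneP : Poly
oneP = + 1 ∷ []

xPlus1 : Poly
xPlus1 = + 1 ∷ + 1 ∷ []

_^P_ : Poly → ℕ → Poly
q ^P zero  = oneP
q ^P suc k = q *P (q ^P k)

prodP : (n : ℕ) → (Fin n → Poly) → Poly
prodP zero    f = oneP
prodP (suc n) f = f zero *P prodP n (f ∘ suc)

coeff : Poly → ℕ → ℤ
coeff []       k       = + 0
coeff (a ∷ q)  zero    = a
coeff (a ∷ q)  (suc k) = coeff q k

-- 𝒫(G;x) = Σ_{i ≥ 1} p(G;i) x^i   (p(G;i) = 0 for i > n)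
PDPoly : {n : ℕ} → Adj n → Poly
PDPoly {n} A = + 0 ∷ applyUpTo (λ j → + p A (suc j)) n

-- The vertex set of the result is the disjoint union of the V(G_i)
-- (the vertex v_i of H being the vertex u_i of G_i), encoded as Fin (total ns).

total : (n : ℕ) → (Fin n → ℕ) → ℕ
total zero    ns = 0
total (suc n) ns = ns zero ℕ.+ total n (ns ∘ suc)

decode : {n : ℕ} (ns : Fin n → ℕ) → Fin (total n ns) → Σ (Fin n) (λ i → Fin (ns i))
decode {suc n} ns k with splitAt (ns zero) k
... | inj₁ a = zero , a
... | inj₂ r with decode (ns ∘ suc) r
...   | i , b = suc i , b

gluedAdjΣ : {n : ℕ} (H : Adj n) (ns : Fin n → ℕ) (Gs : (i : Fin n) → Adj (ns i))
            (us : (i : Fin n) → Fin (ns i)) →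
            Σ (Fin n) (λ i → Fin (ns i)) → Σ (Fin n) (λ i → Fin (ns i)) → Bool
gluedAdjΣ H ns Gs us (i , a) (j , b) = inside ∨ (H i j ∧ ⌊ a Fin.≟ us i ⌋ ∧ ⌊ b Fin.≟ us j ⌋)
  where
    inside : Bool
    inside with i Fin.≟ j
    ... | yes refl = Gs i a b
    ... | no _     = false

gluedAdj : {n : ℕ} (H : Adj n) (ns : Fin n → ℕ) (Gs : (i : Fin n) → Adj (ns i))
           (us : (i : Fin n) → Fin (ns i)) → Adj (total n ns)
gluedAdj H ns Gs us x y = gluedAdjΣ H ns Gs us (decode ns x) (decode ns y)

module Submission where

-- The proof is a characterisation followed by a count.
--
--  * Characterisation (`pd≡meetsAll`): a vertex set S of the glued graph G is
--    power dominating iff S meets every block V(G_i).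
--    - Sufficiency: for s ∈ S ∩ V(G_i) the singleton {s} power dominates G_i,
--      and every forcing step of that process is replayed inside G.  Only
--      u_i may have neighbours outside V(G_i), so we first replay until u_i
--      is coloured (forcers other than u_i behave as in G_i), then, with every
--      u_j coloured, replay the whole process.
--    - Necessity: if S misses V(G_i), then inside V(G_i) only u_i can be
--      coloured by domination, and every later forcing extends an induced path
--      starting at u_i by one vertex ("chains").  If everything gets coloured,
--      G_i is a path with endpoint u_i, which the hypotheses exclude.
--  * Count (`count-meetsAll`): the number of i-subsets of a disjoint union of
--    blocks meeting every block is the x^i coefficient of ∏ ((x+1)^{n_i} - 1),
--    by a product formula for counts over V₁ ⊎ V₂ and the binomial theorem.

open import Defs
open import Data.Nat as ℕ using (ℕ; zero; suc; _≡ᵇ_; _≤_; _<_; z≤n; s≤s; NonZero)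
import Data.Nat.Properties as ℕP
open import Data.Nat.Solver using (module +-*-Solver)
open import Data.Integer as ℤ using (ℤ; +_)
import Data.Integer.Properties as ℤP
open import Data.Bool using (Bool; true; false; _∧_; _∨_; not; if_then_else_; T)
import Data.Bool.Properties as BP
open import Data.Bool.Properties using (T?)
open import Data.Fin as Fin using (Fin; zero; suc; toℕ; _↑ˡ_; _↑ʳ_; splitAt)
import Data.Fin.Properties as FP
open import Data.Fin.Subset using (Subset; ∣_∣; ⁅_⁆)
import Data.Fin.Subset.Properties as SP
open import Data.Vec as Vec using ([]; _∷_)
import Data.Vec.Properties as VP
open import Data.List as List using (List; []; _∷_; allFin; filterᵇ; length; applyUpTo; _++_; tabulate)
import Data.List.Properties as LP
open import Data.List.Relation.Unary.All as All using (All)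
import Data.List.Relation.Unary.All.Properties as AllP
open import Data.List.Relation.Unary.Any using (here; there)
import Data.List.Relation.Unary.Any.Properties as AnyP
open import Data.List.Membership.Propositional using (_∈_)
import Data.List.Membership.Propositional.Properties as MP
open import Data.Bool.ListAction using (any; all)
open import Data.Product as Product using (∃; _,_; _×_; proj₁; proj₂)
open import Data.Sum using (_⊎_; inj₁; inj₂)
open import Data.Empty using (⊥; ⊥-elim)
open import Function using (_∘_; id)
open import Function.Bundles using (Equivalence)
open import Relation.Binary.PropositionalEquality
open import Relation.Nullary using (¬_; yes; no)
open import Relation.Nullary.Decidable using (⌊_⌋; toWitness)

open Equivalence using (to; from)

true≢false : true ≢ false
true≢false ()

∨-true⁻ : ∀ {a b} → a ∨ b ≡ true → a ≡ true ⊎ b ≡ true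
∨-true⁻ {true}  _ = inj₁ refl
∨-true⁻ {false} e = inj₂ e

∧-true⁻ : ∀ {a b} → a ∧ b ≡ true → a ≡ true × b ≡ true
∧-true⁻ {true} e = refl , e

any-allFin⁻ : ∀ {n} (P : Fin n → Bool) → any P (allFin n) ≡ true → ∃ λ i → P i ≡ true
any-allFin⁻ {n} P e =
  Product.map id (to BP.T-≡) (AnyP.tabulate⁻ (AnyP.any⁻ P (allFin n) (from BP.T-≡ e)))

any-allFin⁺ : ∀ {n} (P : Fin n → Bool) i → P i ≡ true → any P (allFin n) ≡ true
any-allFin⁺ P i e = to BP.T-≡ (AnyP.any⁺ P (AnyP.tabulate⁺ i (from BP.T-≡ e)))

all-allFin⁻ : ∀ {n} (P : Fin n → Bool) → all P (allFin n) ≡ true → ∀ i → P i ≡ true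
all-allFin⁻ {n} P e i = to BP.T-≡ (AllP.tabulate⁻ (AllP.all⁺ P (allFin n) (from BP.T-≡ e)) i)

all-allFin⁺ : ∀ {n} (P : Fin n → Bool) → (∀ i → P i ≡ true) → all P (allFin n) ≡ true
all-allFin⁺ P h = to BP.T-≡ (AllP.all⁻ P (AllP.tabulate⁺ (from BP.T-≡ ∘ h)))

⊆-or-new : ∀ {N} (C D : Fin N → Bool) →
  (∀ v → D v ≡ true → C v ≡ true) ⊎ ∃ λ v → D v ≡ true × C v ≡ false
⊆-or-new C D with FP.any? (λ v → (D v ∧ not (C v)) BP.≟ true)
... | yes (v , e) = inj₂ (v , proj₁ (∧-true⁻ e) , to BP.T-not-≡ (from BP.T-≡ (proj₂ (∧-true⁻ {D v} e))))
... | no none = inj₁ λ v dv → BP.¬-not λ cv → none (v , new v dv cv)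
  where
    new : ∀ v → D v ≡ true → C v ≡ false → D v ∧ not (C v) ≡ true
    new v dv cv rewrite dv | cv = refl

count : {A : Set} → (A → Bool) → List A → ℕ
count P xs = length (filterᵇ P xs)

count-++ : ∀ {A : Set} (P : A → Bool) xs ys → count P (xs ++ ys) ≡ count P xs ℕ.+ count P ys
count-++ P xs ys = trans (cong length (LP.filter-++ (T? ∘ P) xs ys)) (LP.length-++ (filterᵇ P xs))

count-map : ∀ {A B : Set} (P : B → Bool) (f : A → B) xs → count P (List.map f xs) ≡ count (P ∘ f) xs
count-map P f [] = refl
count-map P f (x ∷ xs) with P (f x)
... | true  = cong suc (count-map P f xs)
... | false = count-map P f xs

count-cong : ∀ {A : Set} {P Q : A → Bool} → (∀ x → P x ≡ Q x) → ∀ xs → count P xs ≡ count Q xs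
count-cong {P = P} {Q} e xs =
  cong length (LP.filter-≐ (T? ∘ P) (T? ∘ Q) ((λ {x} → subst T (e x)) , (λ {x} → subst T (sym (e x)))) xs)

count-none : ∀ {A : Set} (P : A → Bool) {xs} → All (λ x → P x ≡ false) xs → count P xs ≡ 0
count-none P none =
  cong length (LP.filter-none (T? ∘ P) (All.map (λ e t → true≢false (trans (sym (to BP.T-≡ t)) e)) none))

count-mono : ∀ {A : Set} (P Q : A → Bool) → (∀ x → P x ≡ true → Q x ≡ true) →
  ∀ xs → count P xs ≤ count Q xs
count-mono P Q P⊆Q [] = z≤n
count-mono P Q P⊆Q (x ∷ xs) with P x in ePx | Q x in eQx
... | true  | true  = s≤s (count-mono P Q P⊆Q xs)
... | true  | false = ⊥-elim (true≢false (trans (sym (P⊆Q x ePx)) eQx))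
... | false | true  = ℕP.m≤n⇒m≤1+n (count-mono P Q P⊆Q xs)
... | false | false = count-mono P Q P⊆Q xs

count-strict : ∀ {A : Set} (P Q : A → Bool) → (∀ x → P x ≡ true → Q x ≡ true) →
  ∀ {x xs} → x ∈ xs → P x ≡ false → Q x ≡ true → count P xs < count Q xs
count-strict P Q P⊆Q {xs = x ∷ xs} (here refl) px qx rewrite px | qx = s≤s (count-mono P Q P⊆Q xs)
count-strict P Q P⊆Q {xs = y ∷ xs} (there x∈xs) px qx with P y in ePy | Q y in eQy
... | true  | true  = s≤s (count-strict P Q P⊆Q x∈xs px qx)
... | true  | false = ⊥-elim (true≢false (trans (sym (P⊆Q y ePy)) eQy))
... | false | true  = ℕP.m≤n⇒m≤1+n (count-strict P Q P⊆Q x∈xs px qx)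
... | false | false = count-strict P Q P⊆Q x∈xs px qx

count-unique : ∀ {A : Set} {n} (P : A → Bool) (f : Fin n → A) (y : Fin n) → P (f y) ≡ true →
  (∀ i → P (f i) ≡ true → i ≡ y) → count P (tabulate f) ≡ 1
count-unique P f zero py only rewrite py =
  cong suc (count-none P (AllP.tabulate⁺ λ i → BP.¬-not λ e → FP.0≢1+n (sym (only (suc i) e))))
count-unique P f (suc y) py only with P (f zero) in e0
... | true  = ⊥-elim (FP.0≢1+n (only zero e0))
... | false = count-unique P (f ∘ suc) y py (λ i e → FP.suc-injective (only (suc i) e))

count-complete : ∀ {A : Set} (Q P : A → Bool) xs → count (λ x → Q x ∧ P x) xs ≡ count Q xs →
  ∀ {x} → x ∈ xs → Q x ≡ true → P x ≡ true
count-complete Q P (y ∷ xs) e (here refl) qy with Q y | P y | e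
... | true | true  | _  = refl
... | true | false | e' = ⊥-elim (ℕP.<-irrefl e' (s≤s (count-mono _ Q (λ x → proj₁ ∘ ∧-true⁻) xs)))
count-complete Q P (y ∷ xs) e (there x∈xs) qx with Q y | P y | e
... | true  | true  | e' = count-complete Q P xs (ℕP.suc-injective e') x∈xs qx
... | true  | false | e' = ⊥-elim (ℕP.<-irrefl e' (s≤s (count-mono _ Q (λ x → proj₁ ∘ ∧-true⁻) xs)))
... | false | _     | e' = count-complete Q P xs e' x∈xs qx

-- Cauchy product of coefficient sequences: conv f g k = Σ_{j ≤ k} f j * g (k - j).
conv : (ℕ → ℤ) → (ℕ → ℤ) → ℕ → ℤ
conv f g zero    = f 0 ℤ.* g 0
conv f g (suc k) = f 0 ℤ.* g (suc k) ℤ.+ conv (f ∘ suc) g k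

conv-cong : ∀ {f f' g g'} → (∀ j → f j ≡ f' j) → (∀ j → g j ≡ g' j) → ∀ k → conv f g k ≡ conv f' g' k
conv-cong ef eg zero    = cong₂ ℤ._*_ (ef 0) (eg 0)
conv-cong ef eg (suc k) = cong₂ ℤ._+_ (cong₂ ℤ._*_ (ef 0) (eg (suc k))) (conv-cong (ef ∘ suc) eg k)

conv-zeroˡ : ∀ g k → conv (λ _ → + 0) g k ≡ + 0
conv-zeroˡ g zero    = ℤP.*-zeroˡ (g 0)
conv-zeroˡ g (suc k) = cong₂ ℤ._+_ (ℤP.*-zeroˡ (g (suc k))) (conv-zeroˡ g k)

coeff-+P : ∀ f g k → coeff (f +P g) k ≡ coeff f k ℤ.+ coeff g k
coeff-+P []      g       k       = sym (ℤP.+-identityˡ _)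
coeff-+P (a ∷ f) []      zero    = sym (ℤP.+-identityʳ _)
coeff-+P (a ∷ f) []      (suc k) = sym (ℤP.+-identityʳ _)
coeff-+P (a ∷ f) (b ∷ g) zero    = refl
coeff-+P (a ∷ f) (b ∷ g) (suc k) = coeff-+P f g k

coeff-scale : ∀ a g k → coeff (List.map (a ℤ.*_) g) k ≡ a ℤ.* coeff g k
coeff-scale a []      k       = sym (ℤP.*-zeroʳ a)
coeff-scale a (b ∷ g) zero    = refl
coeff-scale a (b ∷ g) (suc k) = coeff-scale a g k

coeff-*P : ∀ f g k → coeff (f *P g) k ≡ conv (coeff f) (coeff g) k
coeff-*P []      g k       = sym (conv-zeroˡ (coeff g) k)
coeff-*P (a ∷ f) g zero    =
  trans (coeff-+P (List.map (a ℤ.*_) g) _ 0) (trans (ℤP.+-identityʳ _) (coeff-scale a g 0))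
coeff-*P (a ∷ f) g (suc k) =
  trans (coeff-+P (List.map (a ℤ.*_) g) _ (suc k)) (cong₂ ℤ._+_ (coeff-scale a g (suc k)) (coeff-*P f g k))

coeff-applyUpTo : ∀ N (f : ℕ → ℤ) → (∀ j → N ≤ j → f j ≡ + 0) → ∀ j → coeff (applyUpTo f N) j ≡ f j
coeff-applyUpTo zero    f high j       = sym (high j z≤n)
coeff-applyUpTo (suc N) f high zero    = refl
coeff-applyUpTo (suc N) f high (suc j) = coeff-applyUpTo N (f ∘ suc) (λ j N≤j → high (suc j) (s≤s N≤j)) j

convℕ : (ℕ → ℕ) → (ℕ → ℕ) → ℕ → ℕ
convℕ f g zero    = f 0 ℕ.* g 0
convℕ f g (suc k) = f 0 ℕ.* g (suc k) ℕ.+ convℕ (f ∘ suc) g k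

-- multiplication by x
shift : (ℕ → ℕ) → ℕ → ℕ
shift f zero    = 0
shift f (suc j) = f j

shift-cong : ∀ {f f'} → (∀ j → f j ≡ f' j) → ∀ k → shift f k ≡ shift f' k
shift-cong e zero    = refl
shift-cong e (suc k) = e k

convℕ-cong : ∀ {f f' g g'} → (∀ j → f j ≡ f' j) → (∀ j → g j ≡ g' j) → ∀ k → convℕ f g k ≡ convℕ f' g' k
convℕ-cong ef eg zero    = cong₂ ℕ._*_ (ef 0) (eg 0)
convℕ-cong ef eg (suc k) = cong₂ ℕ._+_ (cong₂ ℕ._*_ (ef 0) (eg (suc k))) (convℕ-cong (ef ∘ suc) eg k)

convℕ-+ˡ : ∀ f h g k → convℕ (λ j → f j ℕ.+ h j) g k ≡ convℕ f g k ℕ.+ convℕ h g k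
convℕ-+ˡ f h g zero    = ℕP.*-distribʳ-+ (g 0) (f 0) (h 0)
convℕ-+ˡ f h g (suc k) rewrite convℕ-+ˡ (f ∘ suc) (h ∘ suc) g k =
  solve 5 (λ a b c x y → (a :+ b) :* c :+ (x :+ y) := (a :* c :+ x) :+ (b :* c :+ y)) refl
    (f 0) (h 0) (g (suc k)) (convℕ (f ∘ suc) g k) (convℕ (h ∘ suc) g k)
  where open +-*-Solver

convℕ-shiftˡ : ∀ f g k → convℕ (shift f) g k ≡ shift (convℕ f g) k
convℕ-shiftˡ f g zero    = refl
convℕ-shiftˡ f g (suc k) = refl

convℕ-constˡ : ∀ f g → (∀ j → f (suc j) ≡ 0) → ∀ k → convℕ f g k ≡ f 0 ℕ.* g k
convℕ-constˡ f g high zero    = refl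
convℕ-constˡ f g high (suc k) = trans (cong (f 0 ℕ.* g (suc k) ℕ.+_) (vanish (f ∘ suc) high k)) (ℕP.+-identityʳ _)
  where
    vanish : ∀ f' → (∀ j → f' j ≡ 0) → ∀ k → convℕ f' g k ≡ 0
    vanish f' e zero    rewrite e 0 = refl
    vanish f' e (suc k) rewrite e 0 = vanish (f' ∘ suc) (e ∘ suc) k

convℕ-cast : ∀ f g k → + convℕ f g k ≡ conv (+_ ∘ f) (+_ ∘ g) k
convℕ-cast f g zero    = ℤP.pos-* (f 0) (g 0)
convℕ-cast f g (suc k) = trans (ℤP.pos-+ (f 0 ℕ.* g (suc k)) _)
  (cong₂ ℤ._+_ (ℤP.pos-* (f 0) (g (suc k))) (convℕ-cast (f ∘ suc) g k))

subsetCount : (m : ℕ) → (Subset m → Bool) → ℕ → ℕ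
subsetCount m P k = count (λ S → (∣ S ∣ ≡ᵇ k) ∧ P S) (allSubsets m)

subsetCount-cong : ∀ m {P Q : Subset m → Bool} → (∀ S → P S ≡ Q S) → ∀ k → subsetCount m P k ≡ subsetCount m Q k
subsetCount-cong m e k = count-cong (λ S → cong ((∣ S ∣ ≡ᵇ k) ∧_) (e S)) (allSubsets m)

-- Pascal's rule: split on whether the first element belongs to the subset.
subsetCount-suc : ∀ m (P : Subset (suc m) → Bool) k →
  subsetCount (suc m) P k ≡ shift (subsetCount m (P ∘ (true ∷_))) k ℕ.+ subsetCount m (P ∘ (false ∷_)) k
subsetCount-suc m P k = trans (count-++ sized (List.map (true ∷_) (allSubsets m)) _)
  (cong₂ ℕ._+_ (trans (count-map sized (true ∷_) (allSubsets m)) (with-first k))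
               (count-map sized (false ∷_) (allSubsets m)))
  where
    sized : Subset (suc m) → Bool
    sized S = (∣ S ∣ ≡ᵇ k) ∧ P S
    with-first : ∀ k → count (λ S → (∣ true ∷ S ∣ ≡ᵇ k) ∧ P (true ∷ S)) (allSubsets m)
                     ≡ shift (subsetCount m (P ∘ (true ∷_))) k
    with-first zero    = count-none _ (All.universal (λ _ → refl) (allSubsets m))
    with-first (suc k) = refl

subsetCount-empty : ∀ m k → m < k → ∀ P → subsetCount m P k ≡ 0
subsetCount-empty zero    (suc k) m<k       P = refl
subsetCount-empty (suc m) (suc k) (s≤s m<k) P = trans (subsetCount-suc m P (suc k))
  (cong₂ ℕ._+_ (subsetCount-empty m k m<k _) (subsetCount-empty m (suc k) (ℕP.m≤n⇒m≤1+n m<k) _))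

subsetCount-⊗ : ∀ a b (P₁ : Subset a → Bool) (P₂ : Subset b → Bool) k →
  subsetCount (a ℕ.+ b) (λ S → P₁ (Vec.take a S) ∧ P₂ (Vec.drop a S)) k
    ≡ convℕ (subsetCount a P₁) (subsetCount b P₂) k
subsetCount-⊗ zero b P₁ P₂ k =
  trans (empty-part (P₁ []) refl) (sym (convℕ-constˡ (subsetCount 0 P₁) (subsetCount b P₂) (λ _ → refl) k))
  where
    empty-part : ∀ c → P₁ [] ≡ c → subsetCount b (λ S → P₁ [] ∧ P₂ S) k ≡ subsetCount 0 P₁ 0 ℕ.* subsetCount b P₂ k
    empty-part true  e rewrite e = sym (ℕP.+-identityʳ _)
    empty-part false e rewrite e = count-none _ (All.universal (λ S → BP.∧-zeroʳ _) (allSubsets b))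
subsetCount-⊗ (suc a) b P₁ P₂ k = begin
    subsetCount (suc a ℕ.+ b) P k
  ≡⟨ subsetCount-suc (a ℕ.+ b) P k ⟩
    shift (subsetCount (a ℕ.+ b) (P ∘ (true ∷_))) k ℕ.+ subsetCount (a ℕ.+ b) (P ∘ (false ∷_)) k
  ≡⟨ cong₂ ℕ._+_ (shift-cong (subsetCount-⊗ a b (P₁ ∘ (true ∷_)) P₂) k) (subsetCount-⊗ a b (P₁ ∘ (false ∷_)) P₂ k) ⟩
    shift (convℕ with₁ g) k ℕ.+ convℕ without₁ g k
  ≡⟨ cong (ℕ._+ convℕ without₁ g k) (sym (convℕ-shiftˡ with₁ g k)) ⟩
    convℕ (shift with₁) g k ℕ.+ convℕ without₁ g k
  ≡⟨ sym (convℕ-+ˡ (shift with₁) without₁ g k) ⟩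
    convℕ (λ j → shift with₁ j ℕ.+ without₁ j) g k
  ≡⟨ convℕ-cong (λ j → sym (subsetCount-suc a P₁ j)) (λ _ → refl) k ⟩
    convℕ (subsetCount (suc a) P₁) g k ∎
  where
    open ≡-Reasoning
    P       = λ S → P₁ (Vec.take (suc a) S) ∧ P₂ (Vec.drop (suc a) S)
    with₁    = subsetCount a (P₁ ∘ (true ∷_))
    without₁ = subsetCount a (P₁ ∘ (false ∷_))
    g       = subsetCount b P₂

conv-oneˡ : ∀ g k → conv (coeff oneP) g k ≡ g k
conv-oneˡ g zero    = ℤP.*-identityˡ (g 0)
conv-oneˡ g (suc k) = trans (cong₂ ℤ._+_ (ℤP.*-identityˡ (g (suc k))) (conv-zeroˡ g k)) (ℤP.+-identityʳ _)

binomial : ∀ m k → + subsetCount m (λ _ → true) k ≡ coeff (xPlus1 ^P m) k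
binomial zero    zero    = refl
binomial zero    (suc k) = refl
binomial (suc m) k = trans (cong +_ (subsetCount-suc m (λ _ → true) k))
  (trans (pascal k) (sym (coeff-*P xPlus1 (xPlus1 ^P m) k)))
  where
    c = subsetCount m (λ _ → true)
    g = coeff (xPlus1 ^P m)
    pascal : ∀ k → + (shift c k ℕ.+ c k) ≡ conv (coeff xPlus1) g k
    pascal zero    = trans (binomial m 0) (sym (ℤP.*-identityˡ (g 0)))
    pascal (suc k) = trans (ℤP.pos-+ (c k) (c (suc k)))
      (trans (ℤP.+-comm (+ c k) (+ c (suc k)))
      (cong₂ ℤ._+_ (trans (binomial m (suc k)) (sym (ℤP.*-identityˡ (g (suc k)))))
                   (trans (binomial m k) (sym (conv-oneˡ g k)))))

binomial-constant : ∀ m → coeff (xPlus1 ^P m) 0 ≡ + 1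
binomial-constant zero    = refl
binomial-constant (suc m) =
  trans (coeff-*P xPlus1 (xPlus1 ^P m) 0) (trans (ℤP.*-identityˡ _) (binomial-constant m))

subsetCount-all-0 : ∀ m → subsetCount m (λ _ → true) 0 ≡ 1
subsetCount-all-0 m = ℤP.+-injective (trans (binomial m 0) (binomial-constant m))

subsetCount-all-1 : ∀ m → subsetCount m (λ _ → true) 1 ≡ m
subsetCount-all-1 zero    = refl
subsetCount-all-1 (suc m) =
  trans (subsetCount-suc m (λ _ → true) 1) (cong₂ ℕ._+_ (subsetCount-all-0 m) (subsetCount-all-1 m))

nonempty : {m : ℕ} → Subset m → Bool
nonempty S = not (∣ S ∣ ≡ᵇ 0)

blockPoly : ℕ → Poly
blockPoly m = (xPlus1 ^P m) -P oneP

blockPoly-constant : ∀ m → coeff (blockPoly m) 0 ≡ + 0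
blockPoly-constant m =
  trans (coeff-+P (xPlus1 ^P m) (negP oneP) 0) (cong (ℤ._+ ℤ.-[1+ 0 ]) (binomial-constant m))

subsetCount-nonempty : ∀ m k → + subsetCount m nonempty k ≡ coeff (blockPoly m) k
subsetCount-nonempty m zero = trans
  (cong +_ (count-none _ (All.universal (λ S → BP.∧-inverseʳ (∣ S ∣ ≡ᵇ 0)) (allSubsets m))))
  (sym (blockPoly-constant m))
subsetCount-nonempty m (suc k) = trans
  (cong +_ (count-cong (λ S → size-positive ∣ S ∣) (allSubsets m)))
  (trans (binomial m (suc k)) (sym (trans (coeff-+P (xPlus1 ^P m) (negP oneP) (suc k)) (ℤP.+-identityʳ _))))
  where
    size-positive : ∀ s → ((s ≡ᵇ suc k) ∧ not (s ≡ᵇ 0)) ≡ ((s ≡ᵇ suc k) ∧ true)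
    size-positive zero    = refl
    size-positive (suc s) = refl

ι : ∀ {n} (ns : Fin n → ℕ) (i : Fin n) → Fin (ns i) → Fin (total n ns)
ι {suc n} ns zero    a = a ↑ˡ total n (ns ∘ suc)
ι {suc n} ns (suc i) b = ns zero ↑ʳ ι (ns ∘ suc) i b

decode-ι : ∀ {n} (ns : Fin n → ℕ) i a → decode ns (ι ns i a) ≡ (i , a)
decode-ι {suc n} ns zero    a rewrite FP.splitAt-↑ˡ (ns zero) a (total n (ns ∘ suc)) = refl
decode-ι {suc n} ns (suc i) b rewrite FP.splitAt-↑ʳ (ns zero) (total n (ns ∘ suc)) (ι (ns ∘ suc) i b)
                                    | decode-ι (ns ∘ suc) i b = refl

ι-injective : ∀ {n} (ns : Fin n → ℕ) i {a b} → ι ns i a ≡ ι ns i b → a ≡ b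
ι-injective {suc n} ns zero    e = FP.↑ˡ-injective _ _ _ e
ι-injective {suc n} ns (suc i) e = ι-injective (ns ∘ suc) i (FP.↑ʳ-injective (ns zero) _ _ e)

data BlockView {n} (ns : Fin n → ℕ) : Fin (total n ns) → Set where
  at : ∀ i a → BlockView ns (ι ns i a)

blockView : ∀ {n} (ns : Fin n → ℕ) x → BlockView ns x
blockView {suc n} ns x with splitAt (ns zero) x in e
... | inj₁ a = subst (BlockView ns) joined (at zero a)
  where joined = trans (cong (Fin.join _ _) (sym e)) (FP.join-splitAt (ns zero) _ x)
... | inj₂ r with blockView (ns ∘ suc) r
...   | at i b = subst (BlockView ns) joined (at (suc i) b)
  where joined = trans (cong (Fin.join _ _) (sym e)) (FP.join-splitAt (ns zero) _ x)

meetsAll : (n : ℕ) (ns : Fin n → ℕ) → Subset (total n ns) → Bool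
meetsAll zero    ns S = true
meetsAll (suc n) ns S = nonempty (Vec.take (ns zero) S) ∧ meetsAll n (ns ∘ suc) (Vec.drop (ns zero) S)

count-meetsAll : ∀ n ns k → + subsetCount (total n ns) (meetsAll n ns) k ≡ coeff (prodP n (blockPoly ∘ ns)) k
count-meetsAll zero    ns zero    = refl
count-meetsAll zero    ns (suc k) = refl
count-meetsAll (suc n) ns k = begin
    + subsetCount (total (suc n) ns) (meetsAll (suc n) ns) k
  ≡⟨ cong +_ (subsetCount-⊗ (ns zero) (total n (ns ∘ suc)) nonempty (meetsAll n (ns ∘ suc)) k) ⟩
    + convℕ (subsetCount (ns zero) nonempty) (subsetCount (total n (ns ∘ suc)) (meetsAll n (ns ∘ suc))) k
  ≡⟨ convℕ-cast _ _ k ⟩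
    conv (+_ ∘ subsetCount (ns zero) nonempty) (+_ ∘ subsetCount (total n (ns ∘ suc)) (meetsAll n (ns ∘ suc))) k
  ≡⟨ conv-cong (subsetCount-nonempty (ns zero)) (count-meetsAll n (ns ∘ suc)) k ⟩
    conv (coeff (blockPoly (ns zero))) (coeff (prodP n (blockPoly ∘ ns ∘ suc))) k
  ≡⟨ sym (coeff-*P (blockPoly (ns zero)) _ k) ⟩
    coeff (prodP (suc n) (blockPoly ∘ ns)) k ∎
  where open ≡-Reasoning

prodP-constant : ∀ n (ns : Fin n → ℕ) → .{{NonZero n}} → coeff (prodP n (blockPoly ∘ ns)) 0 ≡ + 0
prodP-constant (suc n) ns = begin
    coeff (prodP (suc n) (blockPoly ∘ ns)) 0
  ≡⟨ coeff-*P (blockPoly (ns zero)) _ 0 ⟩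
    coeff (blockPoly (ns zero)) 0 ℤ.* coeff (prodP n (blockPoly ∘ ns ∘ suc)) 0
  ≡⟨ cong (ℤ._* coeff (prodP n (blockPoly ∘ ns ∘ suc)) 0) (blockPoly-constant (ns zero)) ⟩
    + 0 ℤ.* coeff (prodP n (blockPoly ∘ ns ∘ suc)) 0
  ≡⟨ ℤP.*-zeroˡ (coeff (prodP n (blockPoly ∘ ns ∘ suc)) 0) ⟩
    + 0 ∎
  where open ≡-Reasoning

lookup-take : ∀ a {b} (S : Subset (a ℕ.+ b)) (i : Fin a) → inS S (i ↑ˡ b) ≡ inS (Vec.take a S) i
lookup-take (suc a) (x ∷ S) zero    = refl
lookup-take (suc a) (x ∷ S) (suc i) = lookup-take a S i

lookup-drop : ∀ a {b} (S : Subset (a ℕ.+ b)) (j : Fin b) → inS S (a ↑ʳ j) ≡ inS (Vec.drop a S) j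
lookup-drop zero    S       j = refl
lookup-drop (suc a) (x ∷ S) j = lookup-drop a S j

nonempty⁻ : ∀ {m} (S : Subset m) → nonempty S ≡ true → ∃ λ a → inS S a ≡ true
nonempty⁻ (true  ∷ S) e = zero , refl
nonempty⁻ (false ∷ S) e = Product.map suc id (nonempty⁻ S e)

empty⁻ : ∀ {m} (S : Subset m) → nonempty S ≡ false → ∀ a → inS S a ≡ false
empty⁻ (false ∷ S) e zero    = refl
empty⁻ (false ∷ S) e (suc a) = empty⁻ S e a

meetsAll⁻ : ∀ n (ns : Fin n → ℕ) S → meetsAll n ns S ≡ true → ∀ i → ∃ λ a → inS S (ι ns i a) ≡ true
meetsAll⁻ (suc n) ns S e zero =
  Product.map id (trans (lookup-take (ns zero) S _)) (nonempty⁻ (Vec.take (ns zero) S) (proj₁ (∧-true⁻ e)))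
meetsAll⁻ (suc n) ns S e (suc i) =
  Product.map id (trans (lookup-drop (ns zero) S _))
    (meetsAll⁻ n (ns ∘ suc) _ (proj₂ (∧-true⁻ {nonempty (Vec.take (ns zero) S)} e)) i)

missesSome⁻ : ∀ n (ns : Fin n → ℕ) S → meetsAll n ns S ≡ false → ∃ λ i → ∀ a → inS S (ι ns i a) ≡ false
missesSome⁻ (suc n) ns S e with nonempty (Vec.take (ns zero) S) in e₁
... | false = zero , λ a → trans (lookup-take (ns zero) S a) (empty⁻ (Vec.take (ns zero) S) e₁ a)
... | true  = Product.map suc (λ h a → trans (lookup-drop (ns zero) S _) (h a))
                (missesSome⁻ n (ns ∘ suc) _ e)

bool-ext : ∀ {b c} → (b ≡ true → c ≡ true) → (c ≡ true → b ≡ true) → b ≡ c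
bool-ext {true}  b⇒c c⇒b = sym (b⇒c refl)
bool-ext {false} {false} b⇒c c⇒b = refl
bool-ext {false} {true}  b⇒c c⇒b = c⇒b refl

-- For an inflationary, extensional step on colourings of Fin N, N rounds
-- reach a closed colouring: each round either is already closed or colours
-- a new vertex, and there are only N vertices.
module FixedPoint {N : ℕ} (step : (Fin N → Bool) → Fin N → Bool)
  (inflationary : ∀ C v → C v ≡ true → step C v ≡ true)
  (extensional : ∀ {C C'} → (∀ v → C v ≡ C' v) → ∀ v → step C v ≡ step C' v) where

  Closed : (Fin N → Bool) → Set
  Closed C = ∀ v → step C v ≡ true → C v ≡ true

  size : (Fin N → Bool) → ℕ
  size C = count C (allFin N)

  size≤N : ∀ C → size C ≤ N
  size≤N C = ℕP.≤-trans (LP.length-filter (T? ∘ C) (allFin N)) (ℕP.≤-reflexive (LP.length-tabulate id))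

  closed-or-grows : ∀ C → Closed C ⊎ size C < size (step C)
  closed-or-grows C with ⊆-or-new C (step C)
  ... | inj₁ closed        = inj₁ closed
  ... | inj₂ (v , sv , cv) = inj₂ (count-strict C (step C) (inflationary C) (MP.∈-allFin v) cv sv)

  closed-step : ∀ {C} → Closed C → Closed (step C)
  closed-step {C} closed v ssv = trans (unchanged v) (closed v (trans (sym (extensional unchanged v)) ssv))
    where
      unchanged : ∀ v → step C v ≡ C v
      unchanged v = bool-ext (closed v) (inflationary C v)

  progress : ∀ D r → Closed (iter r step D) ⊎ r ≤ size (iter r step D)
  progress D zero = inj₂ z≤n
  progress D (suc r) with progress D r | closed-or-grows (iter r step D)
  ... | inj₁ closed | _            = inj₁ (closed-step closed)
  ... | inj₂ _      | inj₁ closed  = inj₁ (closed-step closed)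
  ... | inj₂ r≤     | inj₂ grows   = inj₂ (ℕP.≤-trans (s≤s r≤) grows)

  -- more than N coloured vertices is impossible
  closed-after-N : ∀ D → Closed (iter N step D)
  closed-after-N D with progress D N | closed-or-grows (iter N step D)
  ... | inj₁ closed | _           = closed
  ... | inj₂ _      | inj₁ closed = closed
  ... | inj₂ N≤     | inj₂ grows  =
    ⊥-elim (ℕP.<-irrefl refl (ℕP.≤-trans (s≤s N≤) (ℕP.≤-trans grows (size≤N _))))

  iter-inflationary : ∀ r D v → D v ≡ true → iter r step D v ≡ true
  iter-inflationary zero    D v e = e
  iter-inflationary (suc r) D v e = inflationary _ v (iter-inflationary r D v e)

≟-true⁻ : ∀ {m} {a b : Fin m} → ⌊ a Fin.≟ b ⌋ ≡ true → a ≡ b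
≟-true⁻ e = toWitness (from BP.T-≡ e)

module Forcing {N : ℕ} (A : Adj N) where

  Forces : (Fin N → Bool) → Fin N → Fin N → Set
  Forces C y v = (C y ≡ true) × (A y v ≡ true) × (∀ w → w ≢ v → A y w ≡ true → C w ≡ true)

  forceStep⁻ : ∀ C v → forceStep A C v ≡ true → C v ≡ true ⊎ ∃ λ y → Forces C y v
  forceStep⁻ C v e with ∨-true⁻ {C v} e
  ... | inj₁ cv = inj₁ cv
  ... | inj₂ e₂ with any-allFin⁻ _ e₂
  ...   | y , ey with ∧-true⁻ {C y} ey
  ...     | cy , ey₂ with ∧-true⁻ {A y v} ey₂
  ...       | ayv , others = inj₂ (y , cy , ayv , λ w w≢v ayw → other w w≢v ayw (all-allFin⁻ _ others w))
    where
      other : ∀ w → w ≢ v → A y w ≡ true → ⌊ w Fin.≟ v ⌋ ∨ not (A y w) ∨ C w ≡ true → C w ≡ true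
      other w w≢v ayw h with w Fin.≟ v
      ... | yes w≡v = ⊥-elim (w≢v w≡v)
      ... | no _ rewrite ayw = h

  forceStep-keeps : ∀ C v → C v ≡ true → forceStep A C v ≡ true
  forceStep-keeps C v e rewrite e = refl

  forceStep-forces : ∀ C y v → Forces C y v → forceStep A C v ≡ true
  forceStep-forces C y v (cy , ayv , others) with C v
  ... | true  = refl
  ... | false = any-allFin⁺ _ y forcer
    where
      other : ∀ w → ⌊ w Fin.≟ v ⌋ ∨ not (A y w) ∨ C w ≡ true
      other w with w Fin.≟ v
      ... | yes _ = refl
      ... | no w≢v with A y w in ayw
      ...   | false = refl
      ...   | true  = others w w≢v ayw
      forcer : C y ∧ A y v ∧ all (λ w → ⌊ w Fin.≟ v ⌋ ∨ not (A y w) ∨ C w) (allFin N) ≡ true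
      forcer rewrite cy | ayv = all-allFin⁺ _ other

  -- a forcing round is monotone, hence extensional in the colouring
  forceStep-mono : ∀ C C' → (∀ v → C v ≡ true → C' v ≡ true) → ∀ v → forceStep A C v ≡ true → forceStep A C' v ≡ true
  forceStep-mono C C' C⊆C' v e with forceStep⁻ C v e
  ... | inj₁ cv                      = forceStep-keeps C' v (C⊆C' v cv)
  ... | inj₂ (y , cy , ayv , others) =
    forceStep-forces C' y v (C⊆C' y cy , ayv , λ w w≢v ayw → C⊆C' w (others w w≢v ayw))

  forceStep-cong : ∀ {C C'} → (∀ v → C v ≡ C' v) → ∀ v → forceStep A C v ≡ forceStep A C' v
  forceStep-cong {C} {C'} e v = bool-ext
    (forceStep-mono C C' (λ w → trans (sym (e w))) v) (forceStep-mono C' C (λ w → trans (e w)) v)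

  domStep⁻ : ∀ S v → domStep A S v ≡ true → inS S v ≡ true ⊎ ∃ λ s → inS S s ≡ true × A s v ≡ true
  domStep⁻ S v e with ∨-true⁻ {inS S v} e
  ... | inj₁ sv = inj₁ sv
  ... | inj₂ e₂ = inj₂ (Product.map id ∧-true⁻ (any-allFin⁻ _ e₂))

  domStep-self : ∀ S v → inS S v ≡ true → domStep A S v ≡ true
  domStep-self S v e rewrite e = refl

  domStep-neighbour : ∀ S s v → inS S s ≡ true → A s v ≡ true → domStep A S v ≡ true
  domStep-neighbour S s v ss asv with inS S v
  ... | true  = refl
  ... | false = any-allFin⁺ _ s (subst (λ b → b ∧ A s v ≡ true) (sym ss) asv)

  open FixedPoint (forceStep A) forceStep-keeps forceStep-cong public

  colored-closed : ∀ S → Closed (colored A S)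
  colored-closed S = closed-after-N (domStep A S)

  colored-⊇ : ∀ S v → domStep A S v ≡ true → colored A S v ≡ true
  colored-⊇ S = iter-inflationary N (domStep A S)

module Glued {n : ℕ} (H : Adj n) (ns : Fin n → ℕ) (Gs : (i : Fin n) → Adj (ns i))
             (us : (i : Fin n) → Fin (ns i)) where

  G : Adj (total n ns)
  G = gluedAdj H ns Gs us

  data GluedEdge (i : Fin n) (a : Fin (ns i)) : (j : Fin n) → Fin (ns j) → Set where
    inside  : ∀ c → Gs i a c ≡ true → GluedEdge i a i c
    between : ∀ {j c} → a ≡ us i → c ≡ us j → GluedEdge i a j c

  private
    hubEdge : ∀ i a j c → (H i j ∧ ⌊ a Fin.≟ us i ⌋ ∧ ⌊ c Fin.≟ us j ⌋) ≡ true → GluedEdge i a j c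
    hubEdge i a j c e with ∧-true⁻ {⌊ a Fin.≟ us i ⌋} (proj₂ (∧-true⁻ {H i j} e))
    ... | a≡u , c≡u = between (≟-true⁻ a≡u) (≟-true⁻ c≡u)

    classify : ∀ i a j c → gluedAdjΣ H ns Gs us (i , a) (j , c) ≡ true → GluedEdge i a j c
    classify i a j c e with i Fin.≟ j
    ... | yes refl = Data.Sum.[ inside c , hubEdge i a i c ] (∨-true⁻ {Gs i a c} e)
    ... | no _     = hubEdge i a j c e

  gluedEdge⁻ : ∀ i a j c → G (ι ns i a) (ι ns j c) ≡ true → GluedEdge i a j c
  gluedEdge⁻ i a j c e rewrite decode-ι ns i a | decode-ι ns j c = classify i a j c e

  gluedEdge-inside : ∀ i a c → Gs i a c ≡ true → G (ι ns i a) (ι ns i c) ≡ true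
  gluedEdge-inside i a c e rewrite decode-ι ns i a | decode-ι ns i c = edge
    where
      edge : gluedAdjΣ H ns Gs us (i , a) (i , c) ≡ true
      edge with i Fin.≟ i
      ... | yes refl rewrite e = refl
      ... | no i≢i = ⊥-elim (i≢i refl)

≡ᵇ-true⁻ : ∀ a b → (a ≡ᵇ b) ≡ true → a ≡ b
≡ᵇ-true⁻ a b e = ℕP.≡ᵇ⇒≡ a b (from BP.T-≡ e)

≡ᵇ-refl : ∀ a → (a ≡ᵇ a) ≡ true
≡ᵇ-refl a = to BP.T-≡ (ℕP.≡⇒≡ᵇ a a refl)

≡ᵇ-false : ∀ {a b} → a ≢ b → (a ≡ᵇ b) ≡ false
≡ᵇ-false {a} {b} a≢b = BP.¬-not (a≢b ∘ ≡ᵇ-true⁻ a b)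

consecutive : ℕ → ℕ → Bool
consecutive p q = (suc p ≡ᵇ q) ∨ (suc q ≡ᵇ p)

consecutive-sym : ∀ p q → consecutive p q ≡ consecutive q p
consecutive-sym p q = BP.∨-comm (suc p ≡ᵇ q) _

consecutive-irrefl : ∀ p → consecutive p p ≡ false
consecutive-irrefl p rewrite ≡ᵇ-false (ℕP.1+n≢n {p}) = refl

another : ∀ {m} (u : Fin m) → m ≢ 1 → ∃ λ x → x ≢ u
another {suc zero}    u       m≢1 = ⊥-elim (m≢1 refl)
another {suc (suc k)} zero    _   = suc zero , λ ()
another {suc (suc k)} (suc w) _   = zero , λ ()

module Chains {m : ℕ} (A : Adj m) (isGraph : IsGraph A) (u : Fin m) where
  open IsGraph isGraph
  open Forcing A using (Forces)

  -- The coloured vertices form an induced path u = x₀ - x₁ - ⋯ - x_tip, with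
  -- x_p at position p, and all neighbours of x₀ … x_{tip-1} are coloured.
  record Chain (C : Fin m → Bool) : Set where
    field
      tip            : ℕ
      pos            : Fin m → ℕ
      root-coloured  : C u ≡ true
      root-pos       : pos u ≡ 0
      pos-injective  : ∀ x y → C x ≡ true → C y ≡ true → pos x ≡ pos y → x ≡ y
      pos≤tip        : ∀ x → C x ≡ true → pos x ≤ tip
      pos-onto       : ∀ p → p ≤ tip → ∃ λ x → C x ≡ true × pos x ≡ p
      induced-path   : ∀ x y → C x ≡ true → C y ≡ true → A x y ≡ consecutive (pos x) (pos y)
      interior-saturated : ∀ x → C x ≡ true → pos x < tip → ∀ z → A x z ≡ true → C z ≡ true

  ChainOrEmpty : (Fin m → Bool) → Set
  ChainOrEmpty C = (∀ a → C a ≡ false) ⊎ Chain C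

  start : ∀ C → (∀ a → a ≢ u → C a ≡ false) → ChainOrEmpty C
  start C only-u with C u in cu
  ... | false = inj₁ λ a → empty a
    where
      empty : ∀ a → C a ≡ false
      empty a with a Fin.≟ u
      ... | yes refl = cu
      ... | no a≢u   = only-u a a≢u
  ... | true = inj₂ record
      { tip = 0 ; pos = λ _ → 0 ; root-coloured = cu ; root-pos = refl
      ; pos-injective = λ x y cx cy _ → trans (is-u x cx) (sym (is-u y cy))
      ; pos≤tip = λ _ _ → z≤n
      ; pos-onto = λ { zero z≤n → u , cu , refl }
      ; induced-path = λ x y cx cy → loop (is-u x cx) (is-u y cy)
      ; interior-saturated = λ _ _ () }
    where
      is-u : ∀ x → C x ≡ true → x ≡ u
      is-u x cx with x Fin.≟ u
      ... | yes x≡u = x≡u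
      ... | no x≢u  = ⊥-elim (true≢false (trans (sym cx) (only-u x x≢u)))
      loop : ∀ {x y} → x ≡ u → y ≡ u → A x y ≡ false
      loop refl refl = irreflexive u

  module Round (C C' : Fin m → Bool) (grows : ∀ a → C a ≡ true → C' a ≡ true)
    (forced : ∀ a → C' a ≡ true → C a ≡ false → a ≢ u → ∃ λ b → Forces C b a) where

    -- from nothing, only u can appear (forcing needs a coloured forcer)
    from-empty : (∀ a → C a ≡ false) → ChainOrEmpty C'
    from-empty empty = start C' λ a a≢u → BP.¬-not λ c'a →
      let (b , cb , _) = forced a c'a (empty a) a≢u in true≢false (trans (sym cb) (empty b))

    unchanged : (∀ x → C' x ≡ true → C x ≡ true) → Chain C → Chain C'
    unchanged back ch = record
      { tip = tip ; pos = pos ; root-coloured = grows u root-coloured ; root-pos = root-pos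
      ; pos-injective = λ x y cx cy → pos-injective x y (back x cx) (back y cy)
      ; pos≤tip = λ x cx → pos≤tip x (back x cx)
      ; pos-onto = λ p p≤ → let (x , cx , px) = pos-onto p p≤ in x , grows x cx , px
      ; induced-path = λ x y cx cy → induced-path x y (back x cx) (back y cy)
      ; interior-saturated = λ x cx lt z az → grows z (interior-saturated x (back x cx) lt z az) }
      where open Chain ch

    module Extend (ch : Chain C) (x : Fin m) (c'x : C' x ≡ true) (cx : C x ≡ false) where
      open Chain ch

      x≢u : x ≢ u
      x≢u refl = true≢false (trans (sym root-coloured) cx)

      old≢x : ∀ z → C z ≡ true → z ≢ x
      old≢x z cz refl = true≢false (trans (sym cz) cx)

      -- interior vertices force nothing new, so every forcer sits at the tip
      forcer-at-tip : ∀ z → C' z ≡ true → C z ≡ false → z ≢ u →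
        ∃ λ b → Forces C b z × pos b ≡ tip
      forcer-at-tip z c'z cz z≢u with forced z c'z cz z≢u
      ... | b , f@(cb , abz , _) with ℕP.m≤n⇒m<n∨m≡n (pos≤tip b cb)
      ...   | inj₁ lt  = ⊥-elim (true≢false (trans (sym (interior-saturated b cb lt z abz)) cz))
      ...   | inj₂ eq  = b , f , eq

      b : Fin m
      b = proj₁ (forcer-at-tip x c'x cx x≢u)

      b-forces : Forces C b x
      b-forces = proj₁ (proj₂ (forcer-at-tip x c'x cx x≢u))

      b-at-tip : pos b ≡ tip
      b-at-tip = proj₂ (proj₂ (forcer-at-tip x c'x cx x≢u))

      -- the tip has only one uncoloured neighbour, so x is the only new vertex
      only-new : ∀ z → C' z ≡ true → C z ≡ true ⊎ z ≡ x
      only-new z c'z with C z in cz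
      ... | true = inj₁ refl
      ... | false with z Fin.≟ x
      ...   | yes z≡x = inj₂ z≡x
      ...   | no z≢x with forcer-at-tip z c'z cz (λ { refl → true≢false (trans (sym root-coloured) cz) })
      ...     | b' , (cb' , ab'z , _) , b'-at-tip with pos-injective b' b cb' (proj₁ b-forces) (trans b'-at-tip (sym b-at-tip))
      ...       | refl = ⊥-elim (true≢false (trans (sym (proj₂ (proj₂ b-forces) z z≢x ab'z)) cz))

      pos' : Fin m → ℕ
      pos' z = if ⌊ z Fin.≟ x ⌋ then suc tip else pos z

      pos'-new : pos' x ≡ suc tip
      pos'-new with x Fin.≟ x
      ... | yes _   = refl
      ... | no x≢x  = ⊥-elim (x≢x refl)

      pos'-old : ∀ z → C z ≡ true → pos' z ≡ pos z
      pos'-old z cz with z Fin.≟ x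
      ... | yes z≡x = ⊥-elim (old≢x z cz z≡x)
      ... | no _    = refl

      new-edges : ∀ w → C w ≡ true → A x w ≡ consecutive (suc tip) (pos w)
      new-edges w cw with w Fin.≟ b
      ... | yes refl = trans (symmetric x b) (trans (proj₁ (proj₂ b-forces)) (sym tip-edge))
        where
          tip-edge : consecutive (suc tip) (pos b) ≡ true
          tip-edge rewrite b-at-tip = trans (cong ((suc (suc tip) ≡ᵇ tip) ∨_) (≡ᵇ-refl tip)) (BP.∨-zeroʳ _)
      ... | no w≢b = trans no-edge (sym not-consecutive)
        where
          w<tip : pos w < tip
          w<tip = ℕP.≤∧≢⇒< (pos≤tip w cw) λ eq → w≢b (pos-injective w b cw (proj₁ b-forces) (trans eq (sym b-at-tip)))
          no-edge : A x w ≡ false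
          no-edge = BP.¬-not λ axw →
            true≢false (trans (sym (interior-saturated w cw w<tip x (trans (symmetric w x) axw))) cx)
          not-consecutive : consecutive (suc tip) (pos w) ≡ false
          not-consecutive rewrite ≡ᵇ-false {suc (suc tip)} {pos w} (λ eq → ℕP.<-asym w<tip (subst (tip <_) eq (ℕP.m<n⇒m<1+n (ℕP.n<1+n tip))))
                                | ≡ᵇ-false {pos w} {tip} (λ eq → ℕP.<-irrefl eq w<tip) = refl

      extended : Chain C'
      extended = record
        { tip = suc tip ; pos = pos' ; root-coloured = grows u root-coloured
        ; root-pos = trans (pos'-old u root-coloured) root-pos
        ; pos-injective = pos'-injective ; pos≤tip = pos'≤tip ; pos-onto = pos'-onto
        ; induced-path = induced-path' ; interior-saturated = interior-saturated' }
        where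
          beyond : ∀ {z} → C z ≡ true → pos z ≢ suc tip
          beyond cz eq = ℕP.<-irrefl refl (ℕP.≤-trans (ℕP.≤-reflexive (sym eq)) (pos≤tip _ cz))

          pos'-injective : ∀ z w → C' z ≡ true → C' w ≡ true → pos' z ≡ pos' w → z ≡ w
          pos'-injective z w c'z c'w eq with only-new z c'z | only-new w c'w
          ... | inj₁ cz   | inj₁ cw   = pos-injective z w cz cw (trans (sym (pos'-old z cz)) (trans eq (pos'-old w cw)))
          ... | inj₁ cz   | inj₂ refl = ⊥-elim (beyond cz (trans (sym (pos'-old z cz)) (trans eq pos'-new)))
          ... | inj₂ refl | inj₁ cw   = ⊥-elim (beyond cw (trans (sym (pos'-old w cw)) (trans (sym eq) pos'-new)))
          ... | inj₂ refl | inj₂ refl = refl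

          pos'≤tip : ∀ z → C' z ≡ true → pos' z ≤ suc tip
          pos'≤tip z c'z with only-new z c'z
          ... | inj₁ cz   rewrite pos'-old z cz = ℕP.m≤n⇒m≤1+n (pos≤tip z cz)
          ... | inj₂ refl rewrite pos'-new     = ℕP.≤-refl

          pos'-onto : ∀ p → p ≤ suc tip → ∃ λ z → C' z ≡ true × pos' z ≡ p
          pos'-onto p p≤ with ℕP.m≤n⇒m<n∨m≡n p≤
          ... | inj₂ refl        = x , c'x , pos'-new
          ... | inj₁ (s≤s p≤tip) =
            let (z , cz , pz) = pos-onto p p≤tip in z , grows z cz , trans (pos'-old z cz) pz

          induced-path' : ∀ z w → C' z ≡ true → C' w ≡ true → A z w ≡ consecutive (pos' z) (pos' w)
          induced-path' z w c'z c'w with only-new z c'z | only-new w c'w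
          ... | inj₁ cz   | inj₁ cw   rewrite pos'-old z cz | pos'-old w cw = induced-path z w cz cw
          ... | inj₂ refl | inj₁ cw   rewrite pos'-old w cw | pos'-new = new-edges w cw
          ... | inj₁ cz   | inj₂ refl rewrite pos'-old z cz | pos'-new =
                trans (symmetric z x) (trans (new-edges z cz) (consecutive-sym (suc tip) (pos z)))
          ... | inj₂ refl | inj₂ refl rewrite pos'-new =
                trans (irreflexive x) (sym (consecutive-irrefl (suc tip)))

          interior-saturated' : ∀ z → C' z ≡ true → pos' z < suc tip → ∀ w → A z w ≡ true → C' w ≡ true
          interior-saturated' z c'z lt w azw with only-new z c'z
          ... | inj₂ refl rewrite pos'-new = ⊥-elim (ℕP.<-irrefl refl lt)
          ... | inj₁ cz with ℕP.m≤n⇒m<n∨m≡n (pos≤tip z cz)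
          ...   | inj₁ z<tip = grows w (interior-saturated z cz z<tip w azw)
          ...   | inj₂ z-at-tip with pos-injective z b cz (proj₁ b-forces) (trans z-at-tip (sym b-at-tip))
          ...     | refl with w Fin.≟ x
          ...       | yes refl = c'x
          ...       | no w≢x   = grows w (proj₂ (proj₂ b-forces) w w≢x azw)

    round : ChainOrEmpty C → ChainOrEmpty C'
    round (inj₁ empty) = from-empty empty
    round (inj₂ ch) with ⊆-or-new C C'
    ... | inj₁ back             = inj₂ (unchanged back ch)
    ... | inj₂ (x , c'x , cx)   = inj₂ (Extend.extended ch x c'x cx)

  module Complete (C : Fin m → Bool) (ch : Chain C) (full : ∀ a → C a ≡ true) where
    open Chain ch

    vertexAt : Fin (suc tip) → Fin m
    vertexAt p = proj₁ (pos-onto (toℕ p) (FP.toℕ≤pred[n] p))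

    pos-vertexAt : ∀ p → pos (vertexAt p) ≡ toℕ p
    pos-vertexAt p = proj₂ (proj₂ (pos-onto (toℕ p) (FP.toℕ≤pred[n] p)))

    tip<m : tip < m
    tip<m = FP.injective⇒≤ {f = vertexAt} λ {p} {q} e →
      FP.toℕ-injective (trans (sym (pos-vertexAt p)) (trans (cong pos e) (pos-vertexAt q)))

    pos<m : ∀ x → pos x < m
    pos<m x = ℕP.≤-<-trans (pos≤tip x (full x)) tip<m

    toℕ-pos : ∀ x → toℕ (Fin.fromℕ< (pos<m x)) ≡ pos x
    toℕ-pos x = FP.toℕ-fromℕ< (pos<m x)

    isPath : IsPath A
    isPath = (λ x → Fin.fromℕ< (pos<m x)) , record
      { injective = λ {a} {b} e →
          pos-injective a b (full a) (full b) (trans (sym (toℕ-pos a)) (trans (cong toℕ e) (toℕ-pos b)))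
      ; preserves = λ a b → trans (induced-path a b (full a) (full b))
          (cong₂ consecutive (sym (toℕ-pos a)) (sym (toℕ-pos b))) }

    root-edges : ∀ z → A u z ≡ (1 ≡ᵇ pos z) ∨ (suc (pos z) ≡ᵇ 0)
    root-edges z = trans (induced-path u z root-coloured (full z))
                         (cong (λ p → (suc p ≡ᵇ pos z) ∨ (suc (pos z) ≡ᵇ p)) root-pos)

    endpoint : IsEndpoint A u
    endpoint with m ℕ.≟ 1
    ... | yes m≡1 = inj₁ m≡1
    ... | no m≢1  = inj₂ (count-unique (A u) id y1 y1-adjacent only-y1)
      where
        x = proj₁ (another u m≢1)
        1≤tip : 1 ≤ tip
        1≤tip = ℕP.≤-trans (ℕP.n≢0⇒n>0 λ px≡0 →
                  proj₂ (another u m≢1) (pos-injective x u (full x) root-coloured (trans px≡0 (sym root-pos))))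
                (pos≤tip x (full x))
        y1 = proj₁ (pos-onto 1 1≤tip)
        pos-y1 : pos y1 ≡ 1
        pos-y1 = proj₂ (proj₂ (pos-onto 1 1≤tip))
        y1-adjacent : A u y1 ≡ true
        y1-adjacent = trans (root-edges y1) (cong (λ q → (1 ≡ᵇ q) ∨ false) pos-y1)
        only-y1 : ∀ z → A u z ≡ true → z ≡ y1
        only-y1 z auz = pos-injective z y1 (full z) (full y1)
          (trans (sym (≡ᵇ-true⁻ 1 (pos z) (trans (sym (BP.∨-identityʳ _)) (trans (sym (root-edges z)) auz)))) (sym pos-y1))

∈-allSubsets : ∀ {m} (S : Subset m) → S ∈ allSubsets m
∈-allSubsets []                = here refl
∈-allSubsets {suc m} (true ∷ S)  = MP.∈-++⁺ˡ (MP.∈-map⁺ (true ∷_) (∈-allSubsets S))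
∈-allSubsets {suc m} (false ∷ S) =
  MP.∈-++⁺ʳ (List.map (true ∷_) (allSubsets m)) (MP.∈-map⁺ (false ∷_) (∈-allSubsets S))

singleton-pd : ∀ {m} (A : Adj m) → p A 1 ≡ m → ∀ a → isPowerDominating A ⁅ a ⁆ ≡ true
singleton-pd {m} A all-singletons a =
  count-complete (λ S → ∣ S ∣ ≡ᵇ 1) (isPowerDominating A) (allSubsets m) all-pass
    (∈-allSubsets ⁅ a ⁆) (cong (_≡ᵇ 1) (SP.∣⁅x⁆∣≡1 a))
  where
    all-pass : p A 1 ≡ count (λ S → ∣ S ∣ ≡ᵇ 1) (allSubsets m)
    all-pass = trans all-singletons (sym (trans
      (count-cong (λ S → sym (BP.∧-identityʳ (∣ S ∣ ≡ᵇ 1))) (allSubsets m)) (subsetCount-all-1 m)))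

∈⁅⁆⁻ : ∀ {m} (a b : Fin m) → inS ⁅ a ⁆ b ≡ true → b ≡ a
∈⁅⁆⁻ a b e = SP.x∈⁅y⁆⇒x≡y a (VP.lookup⇒[]= b ⁅ a ⁆ e)

module Characterisation {n : ℕ} (H : Adj n) (ns : Fin n → ℕ) (Gs : (i : Fin n) → Adj (ns i))
  (isGraph : (i : Fin n) → IsGraph (Gs i))
  (all-singletons : (i : Fin n) → p (Gs i) 1 ≡ ns i)
  (us : (i : Fin n) → Fin (ns i))
  (not-endpoint : (i : Fin n) → IsPath (Gs i) → ¬ IsEndpoint (Gs i) (us i)) where

  open Glued H ns Gs us
  open Forcing G

  N : ℕ
  N = total n ns

  -- If S misses block i, the colouring inside block i is always a chain
  -- from u_i, so colouring all of it would make G_i a path ending at u_i.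
  module Necessity (S : Subset N) (i : Fin n) (misses : ∀ a → inS S (ι ns i a) ≡ false) where
    open Chains (Gs i) (isGraph i) (us i)

    colouring : ℕ → Fin N → Bool
    colouring r = iter r (forceStep G) (domStep G S)

    block : ℕ → Fin (ns i) → Bool
    block r a = colouring r (ι ns i a)

    dominated⊆hub : ∀ a → a ≢ us i → block 0 a ≡ false
    dominated⊆hub a a≢u = BP.¬-not λ d → not-dominated (domStep⁻ S (ι ns i a) d)
      where
        not-dominated : inS S (ι ns i a) ≡ true ⊎ ∃ (λ s → inS S s ≡ true × G s (ι ns i a) ≡ true) → ⊥
        not-dominated (inj₁ sa) = true≢false (trans (sym sa) (misses a))
        not-dominated (inj₂ (s , ss , edge)) with blockView ns s
        ... | at j c with gluedEdge⁻ j c i a edge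
        ...   | inside .a _ = true≢false (trans (sym ss) (misses c))
        ...   | between _ a≡u = a≢u a≡u

    forced-inside : ∀ r a → block (suc r) a ≡ true → block r a ≡ false → a ≢ us i →
      ∃ λ b → Forcing.Forces (Gs i) (block r) b a
    forced-inside r a now before a≢u with forceStep⁻ (colouring r) (ι ns i a) now
    ... | inj₁ was = ⊥-elim (true≢false (trans (sym was) before))
    ... | inj₂ (y , cy , edge , others) with blockView ns y
    ...   | at j b with gluedEdge⁻ j b i a edge
    ...     | between _ a≡u = ⊥-elim (a≢u a≡u)
    ...     | inside .a gba = b , cy , gba , λ c c≢a gbc →
                others (ι ns i c) (c≢a ∘ ι-injective ns i) (gluedEdge-inside i b c gbc)

    chain-or-empty : ∀ r → ChainOrEmpty (block r)
    chain-or-empty zero    = start (block 0) dominated⊆hub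
    chain-or-empty (suc r) =
      Round.round (block r) (block (suc r)) (λ a → forceStep-keeps (colouring r) (ι ns i a))
        (forced-inside r) (chain-or-empty r)

    not-pd : isPowerDominating G S ≡ false
    not-pd = BP.¬-not λ pd → contradiction (chain-or-empty N) (λ a → all-allFin⁻ (colored G S) pd (ι ns i a))
      where
        contradiction : ChainOrEmpty (block N) → (∀ a → block N a ≡ true) → ⊥
        contradiction (inj₁ empty) full = true≢false (trans (sym (full (us i))) (empty (us i)))
        contradiction (inj₂ ch)    full = not-endpoint i isPath endpoint
          where open Complete (block N) ch full

  -- If S contains s in every block, the power domination of G_i by {s} is
  -- replayed inside G, first up to the colouring of u_i, then completely.
  module Sufficiency (S : Subset N) (meets : ∀ i → ∃ λ a → inS S (ι ns i a) ≡ true) where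

    final : Fin N → Bool
    final = colored G S

    force : ∀ y v → Forces final y v → final v ≡ true
    force y v f = colored-closed S v (forceStep-forces final y v f)

    AllHubs : Set
    AllHubs = ∀ j → final (ι ns j (us j)) ≡ true

    module Replay (i : Fin n) where
      module Gi = Forcing (Gs i)

      s : Fin (ns i)
      s = proj₁ (meets i)

      Ci : ℕ → Fin (ns i) → Bool
      Ci r = iter r (forceStep (Gs i)) (domStep (Gs i) ⁅ s ⁆)

      replay-domination : ∀ a → Ci 0 a ≡ true → final (ι ns i a) ≡ true
      replay-domination a d with Gi.domStep⁻ ⁅ s ⁆ a d
      ... | inj₁ a∈ with ∈⁅⁆⁻ s a a∈
      ...   | refl = colored-⊇ S _ (domStep-self S _ (proj₂ (meets i)))
      replay-domination a d | inj₂ (s' , s'∈ , edge) with ∈⁅⁆⁻ s s' s'∈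
      ... | refl = colored-⊇ S _ (domStep-neighbour S _ _ (proj₂ (meets i)) (gluedEdge-inside i s a edge))

      -- one forcing round of G_i is replayed in G, provided the hubs are
      -- coloured whenever u_i can act as a forcer
      replay-round : ∀ r → (Ci r (us i) ≡ true → AllHubs) → (∀ a → Ci r a ≡ true → final (ι ns i a) ≡ true) →
        ∀ a → Ci (suc r) a ≡ true → final (ι ns i a) ≡ true
      replay-round r hubs previous a now with Gi.forceStep⁻ (Ci r) a now
      ... | inj₁ was = previous a was
      ... | inj₂ (b , cb , edge , others) =
        force (ι ns i b) (ι ns i a) (previous b cb , gluedEdge-inside i b a edge , other-neighbours)
        where
          other-neighbours : ∀ w → w ≢ ι ns i a → G (ι ns i b) w ≡ true → final w ≡ true
          other-neighbours w w≢a gw with blockView ns w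
          ... | at j c with gluedEdge⁻ i b j c gw
          ...   | inside .c g     = previous c (others c (w≢a ∘ cong (ι ns i)) g)
          ...   | between b≡u c≡u = subst (λ c → final (ι ns j c) ≡ true) (sym c≡u) (hubs (subst (λ b → Ci r b ≡ true) b≡u cb) j)

      before-hub : ∀ r → Ci r (us i) ≡ false → ∀ a → Ci r a ≡ true → final (ι ns i a) ≡ true
      before-hub zero    _    = replay-domination
      before-hub (suc r) no-u = replay-round r (⊥-elim ∘ not-yet) (before-hub r (BP.¬-not not-yet))
        where
          not-yet : Ci r (us i) ≢ true
          not-yet u = true≢false (trans (sym (Gi.forceStep-keeps (Ci r) (us i) u)) no-u)

      hub-coloured : ∀ r → Ci r (us i) ≡ true → final (ι ns i (us i)) ≡ true
      hub-coloured zero    now = replay-domination (us i) now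
      hub-coloured (suc r) now with Ci r (us i) BP.≟ true
      ... | yes was = hub-coloured r was
      ... | no  not-yet = replay-round r (⊥-elim ∘ not-yet) (before-hub r (BP.¬-not not-yet)) (us i) now

      Gi-coloured : ∀ a → Ci (ns i) a ≡ true
      Gi-coloured = all-allFin⁻ _ (singleton-pd (Gs i) (all-singletons i) s)

      replay : AllHubs → ∀ r a → Ci r a ≡ true → final (ι ns i a) ≡ true
      replay hubs zero    = replay-domination
      replay hubs (suc r) = replay-round r (λ _ → hubs) (replay hubs r)

    hubs : AllHubs
    hubs j = Replay.hub-coloured j (ns j) (Replay.Gi-coloured j (us j))

    pd : isPowerDominating G S ≡ true
    pd = all-allFin⁺ final coloured
      where
        coloured : ∀ x → final x ≡ true
        coloured x with blockView ns x
        ... | at i a = Replay.replay i hubs (ns i) a (Replay.Gi-coloured i a)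

  pd≡meetsAll : ∀ S → isPowerDominating G S ≡ meetsAll n ns S
  pd≡meetsAll S with meetsAll n ns S in e
  ... | true  = Sufficiency.pd S (meetsAll⁻ n ns S e)
  ... | false = let (i , misses) = missesSome⁻ n ns S e in Necessity.not-pd S i misses

theorem20 : (n : ℕ) → .{{_ : NonZero n}} →
    (H : Adj n) → IsGraph H →
    (ns : Fin n → ℕ) → (Gs : (i : Fin n) → Adj (ns i)) →
    ((i : Fin n) → IsGraph (Gs i)) →
    ((i : Fin n) → p (Gs i) 1 ≡ ns i) →
    (us : (i : Fin n) → Fin (ns i)) →
    ((i : Fin n) → IsPath (Gs i) → ¬ IsEndpoint (Gs i) (us i)) →
    (k : ℕ) →
    coeff (PDPoly (gluedAdj H ns Gs us)) k
      ≡ coeff (prodP n (λ i → (xPlus1 ^P ns i) -P oneP)) k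
theorem20 n H _ ns Gs isGraph all-singletons us not-endpoint zero = sym (prodP-constant n ns)
theorem20 n H _ ns Gs isGraph all-singletons us not-endpoint (suc k) = begin
    coeff (PDPoly G) (suc k)
  ≡⟨ coeff-applyUpTo N (λ j → + p G (suc j)) (λ j N≤j → cong +_ (subsetCount-empty N (suc j) (s≤s N≤j) _)) k ⟩
    + subsetCount N (isPowerDominating G) (suc k)
  ≡⟨ cong +_ (subsetCount-cong N pd≡meetsAll (suc k)) ⟩
    + subsetCount N (meetsAll n ns) (suc k)
  ≡⟨ count-meetsAll n ns (suc k) ⟩
    coeff (prodP n (blockPoly ∘ ns)) (suc k) ∎
  where
    open ≡-Reasoning
    open Glued H ns Gs us using (G)
    open Characterisation H ns Gs isGraph all-singletons us not-endpoint using (N; pd≡meetsAll)
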